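{- Let $k\ge 4$ and $t\ge 1$ be integers and let $C=C_{k,t}$ be the tower complex with base $V_0$. For every $A\subseteq V(C)$: if $|A|\ge 2$ then $\rho_{k,C}(A)\ge 2(k+1)(k-2)-2(k-1)$; moreover, if $A\supseteq V_0$ then $\rho_{k,C}(A)\ge 2(k+1)(k-2)$.
   Context: The tower $T_{k,t}$ has vertex set $V_0\cup V_1\cup\dots\cup V_t$ with $V_0=\{v_{0,0},v_{0,1}\}$ and $V_i=\{v_{i,0},\dots,v_{i,k-2}\}$ for $1\le i\le t$; for $1\le i\le t$, $V_i$ induces $K_{k-1}$ minus the edge $v_{i,0}v_{i,1}$, the vertex $v_{i-1,0}$ is adjacent to $v_{i,j}$ for all $0\le j\le (k-2)/2$, and $v_{i-1,1}$ is adjacent to $v_{i,j}$ for all $(k-1)/2\le j\le k-2$; there are no other edges. The tower complex $C_{k,t}$ is the union of $k$ copies $T^1,\dots,T^k$ of $T_{k,t}$ sharing the common base $V_0=\{v_{0,0},v_{0,1}\}$, otherwise vertex-disjoint, with no edges between $T^i-V_0$ and $T^j-V_0$ for $i\ne j$; $V_0$ is the base of $C_{k,t}$. For a graph $H$ and $A\subseteq V(H)$, $\rho_{k,H}(A)=(k+1)(k-2)|A|-2(k-1)|E(H[A])|$. -}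

module Defs where

open import Data.Nat using (ℕ; zero; suc; _+_; _*_; _∸_; _≤ᵇ_; _≡ᵇ_)
open import Data.Integer as ℤ using (ℤ; +_; _-_)
open import Data.Fin using (Fin; toℕ)
open import Data.Bool using (Bool; true; false; _∧_; _∨_; not; if_then_else_)
open import Data.List using (List; []; _∷_; _++_; map; concatMap; allFin)
open import Data.Product using (_×_; _,_)

-- Vertices of the tower complex C_{k,t}.
--   base b        : v_{0,b}  (b ∈ {0,1}), the common base V_0
--   tw c i j      : vertex v_{i+1,j} of copy T^{c+1}  (c < k, i < t, j ≤ k-2)
data Vtx (k t : ℕ) : Set where
  base : Fin 2 → Vtx k t
  tw   : Fin k → Fin t → Fin (k ∸ 1) → Vtx k t

-- v_{i-1,b} adjacent to v_{i,j}:
--   b = 0 : 0 ≤ j ≤ (k-2)/2     i.e.  2j ≤ k-2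
--   b = 1 : (k-1)/2 ≤ j ≤ k-2   i.e.  k-1 ≤ 2j
downAdj : (k b j : ℕ) → Bool
downAdj k zero j = (2 * j) ≤ᵇ (k ∸ 2)
downAdj k (suc zero) j = (k ∸ 1) ≤ᵇ (2 * j)
downAdj k (suc (suc _)) j = false

edgeDir : {k t : ℕ} → Vtx k t → Vtx k t → Bool
edgeDir {k} (base b) (tw c i j) = (toℕ i ≡ᵇ 0) ∧ downAdj k (toℕ b) (toℕ j)
edgeDir {k} (tw c i j) (tw c' i' j') =
  (toℕ c ≡ᵇ toℕ c') ∧
  ( -- same level i+1: K_{k-1} minus the edge v_{i+1,0} v_{i+1,1}
    ((toℕ i ≡ᵇ toℕ i') ∧ (suc (toℕ j) ≤ᵇ toℕ j')
        ∧ not ((toℕ j ≡ᵇ 0) ∧ (toℕ j' ≡ᵇ 1)))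
  ∨
    ((suc (toℕ i) ≡ᵇ toℕ i') ∧ downAdj k (toℕ j) (toℕ j')))
edgeDir _ _ = false

adj : {k t : ℕ} → Vtx k t → Vtx k t → Bool
adj u v = edgeDir u v ∨ edgeDir v u

allV : (k t : ℕ) → List (Vtx k t)
allV k t =
  base Data.Fin.zero ∷ base (Data.Fin.suc Data.Fin.zero) ∷
  concatMap (λ c → concatMap (λ i → map (tw c i) (allFin (k ∸ 1))) (allFin t)) (allFin k)

count : {X : Set} → (X → Bool) → List X → ℕ
count p [] = 0
count p (x ∷ xs) = if p x then suc (count p xs) else count p xs

filterB : {X : Set} → (X → Bool) → List X → List X
filterB p [] = []
filterB p (x ∷ xs) = if p x then x ∷ filterB p xs else filterB p xs

pairs : {X : Set} → List X → List (X × X)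
pairs [] = []
pairs (x ∷ xs) = map (λ y → (x , y)) xs ++ pairs xs

card : {k t : ℕ} → (Vtx k t → Bool) → ℕ
card {k} {t} A = count A (allV k t)

edgesIn : {k t : ℕ} → (Vtx k t → Bool) → ℕ
edgesIn {k} {t} A = count (λ { (u , v) → adj u v }) (pairs (filterB A (allV k t)))

ρ : (k t : ℕ) → (Vtx k t → Bool) → ℤ
ρ k t A = + ((k + 1) * (k ∸ 2) * card A) - + (2 * (k ∸ 1) * edgesIn A)

-- Write φ(s, c) = (k+1)(k-2) s - 2(k-1) c, so that ρ(A) = φ(|A|, |E(C[A])|). Each copy of the
-- tower is a chain of levels, each inducing K_(k-1) minus an edge, and a level meets the rest of
-- the complex only through the two ends of the missing edge of the level above it (for the first
-- level: through the base). For a piece P of the complex hanging below two such attachment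
-- vertices, let c count the edges of C[A] inside P or joining P to an attachment vertex in A.
-- By induction from the deepest level upwards, φ(|A ∩ P|, c) ≥ 0; if one attachment vertex is in A
-- and P meets A, it is ≥ (k+1)(k-2) - 2(k-1); if none is and P meets A, it is ≥ (k+1)(k-2), and
-- even ≥ 2(k+1)(k-2) - 2(k-1) once |A ∩ P| ≥ 2. For a single level these are quadratic
-- inequalities in |A ∩ V_i|, since |E(C[A ∩ V_i])| is determined by |A ∩ V_i| and whether both
-- ends of the missing edge are in A; at most about half of a level is joined to each attachment
-- vertex. The bounds survive putting a piece below the attachment vertices of a level, and
-- putting pieces with the same attachment vertices side by side. The theorem follows by adding the
-- base to the union of the k towers.
module Submission where

open import Defs
open import Data.Nat using (ℕ; _+_; _*_; _∸_; _≤_)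
open import Data.Integer as ℤ using (+_; _-_)
open import Data.Fin using (zero; suc)
open import Data.Bool using (Bool; true)
open import Data.Product using (_×_)
open import Relation.Binary.PropositionalEquality using (_≡_)

open import Data.Bool using (false; _∧_; T; if_then_else_)
open import Data.Bool.Properties using (∧-zeroʳ; ∧-identityʳ; ∨-identityʳ; T-≡)
open import Data.Empty using (⊥-elim)
open import Data.Fin using (Fin; toℕ; _↑ʳ_)
open import Data.Integer using (ℤ; 0ℤ; +≤+)
import Data.Integer.Properties as ℤ
open import Data.Integer.Tactic.RingSolver renaming (solve-∀ to solve-∀ℤ)
open import Data.List using (List; []; _∷_; _++_; map; concatMap; tabulate; allFin; length)
open import Data.List.Properties using (map-tabulate; length-tabulate)
open import Data.List.Relation.Unary.All using (All; []; _∷_)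
import Data.List.Relation.Unary.All.Properties as All
open import Data.List.Relation.Unary.AllPairs using (AllPairs; []; _∷_)
import Data.List.Relation.Unary.AllPairs.Properties as AllPairs
open import Data.Nat using (zero; suc; _<_; _≤ᵇ_; _≡ᵇ_; z≤n; s≤s)
open import Data.Nat.Properties
open import Data.Nat.Tactic.RingSolver using (solve-∀)
open import Algebra.Properties.CommutativeSemigroup +-commutativeSemigroup using (interchange)
open import Data.Product using (_,_; proj₁; proj₂; uncurry)
open import Data.Sum using (_⊎_; inj₁; inj₂)
open import Function using (_∘_; id)
open import Function.Bundles using (Equivalence)
open import Relation.Binary.PropositionalEquality
  using (_≢_; refl; cong; cong₂; subst; subst₂; sym; trans; ≢-sym; module ≡-Reasoning)
open import Relation.Nullary using (contradiction)

ι : Bool → ℕ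
ι b = if b then 1 else 0

ι≤1 : ∀ b → ι b ≤ 1
ι≤1 true = ≤-refl
ι≤1 false = z≤n

if-+ : ∀ b x y → (if b then x + y else 0) ≡ (if b then x else 0) + (if b then y else 0)
if-+ true x y = refl
if-+ false x y = refl

module _ {X : Set} where

  count-∷ : ∀ (p : X → Bool) x xs → count p (x ∷ xs) ≡ ι (p x) + count p xs
  count-∷ p x xs with p x
  ... | true = refl
  ... | false = refl

  count-pair : ∀ (p : X → Bool) x y → count p (x ∷ y ∷ []) ≡ ι (p x) + ι (p y)
  count-pair p x y =
    trans (count-∷ p x (y ∷ [])) (cong (_+_ (ι (p x))) (trans (count-∷ p y []) (+-identityʳ _)))

  count-++ : ∀ (p : X → Bool) xs ys → count p (xs ++ ys) ≡ count p xs + count p ys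
  count-++ p [] ys = refl
  count-++ p (x ∷ xs) ys with p x
  ... | true = cong suc (count-++ p xs ys)
  ... | false = count-++ p xs ys

  count-cong : ∀ {p q : X → Bool} xs → (∀ x → p x ≡ q x) → count p xs ≡ count q xs
  count-cong [] _ = refl
  count-cong {q = q} (x ∷ xs) p≗q rewrite p≗q x with q x
  ... | true = cong suc (count-cong xs p≗q)
  ... | false = count-cong xs p≗q

  count-filterB : ∀ (p q : X → Bool) xs → count p (filterB q xs) ≡ count (λ x → q x ∧ p x) xs
  count-filterB p q [] = refl
  count-filterB p q (x ∷ xs) with q x
  ... | false = count-filterB p q xs
  ... | true with p x
  ...   | true = cong suc (count-filterB p q xs)
  ...   | false = count-filterB p q xs

  count-≤-length : ∀ (p : X → Bool) xs → count p xs ≤ length xs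
  count-≤-length p [] = z≤n
  count-≤-length p (x ∷ xs) with p x
  ... | true = s≤s (count-≤-length p xs)
  ... | false = m≤n⇒m≤1+n (count-≤-length p xs)

  count-∧-≤ : ∀ (p q : X → Bool) xs → count (λ x → p x ∧ q x) xs ≤ count q xs
  count-∧-≤ p q [] = z≤n
  count-∧-≤ p q (x ∷ xs) with p x | q x
  ... | true | true = s≤s (count-∧-≤ p q xs)
  ... | true | false = count-∧-≤ p q xs
  ... | false | true = m≤n⇒m≤1+n (count-∧-≤ p q xs)
  ... | false | false = count-∧-≤ p q xs

  count-∧-disjoint : ∀ (p q r : X → Bool) xs → (∀ x → q x ∧ r x ≡ false) →
                     count (λ x → p x ∧ q x) xs + count (λ x → p x ∧ r x) xs ≤ count p xs
  count-∧-disjoint p q r [] _ = z≤n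
  count-∧-disjoint p q r (x ∷ xs) q∧r with p x | q x | r x | q∧r x
  ... | false | _ | _ | _ = count-∧-disjoint p q r xs q∧r
  ... | true | true | false | _ = s≤s (count-∧-disjoint p q r xs q∧r)
  ... | true | false | true | _ =
    subst (_≤ suc (count p xs)) (sym (+-suc _ _)) (s≤s (count-∧-disjoint p q r xs q∧r))
  ... | true | false | false | _ = m≤n⇒m≤1+n (count-∧-disjoint p q r xs q∧r)

module _ {X Y : Set} where

  count-map : ∀ (p : Y → Bool) (f : X → Y) xs → count p (map f xs) ≡ count (p ∘ f) xs
  count-map p f [] = refl
  count-map p f (x ∷ xs) with p (f x)
  ... | true = cong suc (count-map p f xs)
  ... | false = count-map p f xs

count-tabulate : ∀ {X : Set} {N} (p : X → Bool) (g : Fin N → X) →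
                 count p (tabulate g) ≡ count (p ∘ g) (allFin N)
count-tabulate p g = trans (cong (count p) (sym (map-tabulate id g))) (count-map p g (allFin _))

m+o≡n⇒m≤n : ∀ {m n o} → m + o ≡ n → m ≤ n
m+o≡n⇒m≤n {m} {o = o} refl = m≤m+n m o

clique-step : ∀ c e → 2 * e + c ≡ c * c → 2 * (c + e) + suc c ≡ suc c * suc c
clique-step c e eq = trans (shift c e) (trans (cong (_+ (2 * c + 1)) eq) (square c))
  where
  shift : ∀ c e → 2 * (c + e) + suc c ≡ 2 * e + c + (2 * c + 1)
  shift = solve-∀
  square : ∀ c → c * c + (2 * c + 1) ≡ suc c * suc c
  square = solve-∀

p+s≤r+q⇒p-q≤r-s : ∀ {p q r s} → p + s ≤ r + q → + p - + q ℤ.≤ + r - + s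
p+s≤r+q⇒p-q≤r-s {p} {q} {r} {s} h = begin
  + p - + q               ≡⟨ sym (cancel p q s) ⟩
  + (p + s) - + (q + s)   ≤⟨ ℤ.+-monoˡ-≤ (ℤ.- + (q + s)) (+≤+ h) ⟩
  + (r + q) - + (q + s)   ≡⟨ cong (λ x → + (r + q) - + x) (+-comm q s) ⟩
  + (r + q) - + (s + q)   ≡⟨ cancel r s q ⟩
  + r - + s               ∎
  where
  open ℤ.≤-Reasoning
  cancel : ∀ a b c → + (a + c) - + (b + c) ≡ + a - + b
  cancel a b c = trans (cong₂ _-_ (ℤ.pos-+ a c) (ℤ.pos-+ b c)) (e (+ a) (+ b) (+ c))
    where
    e : ∀ a b c → (a ℤ.+ c) - (b ℤ.+ c) ≡ a - b
    e = solve-∀ℤ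

≤-+-nonnegʳ : ∀ {β x y} → β ℤ.≤ x → 0ℤ ℤ.≤ y → β ℤ.≤ x ℤ.+ y
≤-+-nonnegʳ {β} h h′ = subst (ℤ._≤ _) (ℤ.+-identityʳ β) (ℤ.+-mono-≤ h h′)

≤-+-nonnegˡ : ∀ {β x y} → 0ℤ ℤ.≤ x → β ℤ.≤ y → β ℤ.≤ x ℤ.+ y
≤-+-nonnegˡ {β} h h′ = subst (ℤ._≤ _) (ℤ.+-identityˡ β) (ℤ.+-mono-≤ h h′)

module Potential (n : ℕ) where

  -- For k = 4 + n, ρ_k weighs a vertex by vw = (k+1)(k-2) and an edge by ew = 2(k-1) = 2m.
  vw ew : ℕ
  vw = (5 + n) * (2 + n)
  ew = 2 * (3 + n)

  private
    m : ℕ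
    m = 3 + n

  m*t≤vw : ∀ {t} → t ≤ m → m * t ≤ vw
  m*t≤vw t≤m = ≤-trans (*-monoʳ-≤ m t≤m) (m+n≤o⇒m≤o _ (≤-reflexive (square n)))
    where
    square : ∀ n → (3 + n) * (3 + n) + (1 + n) ≡ (5 + n) * (2 + n)
    square = solve-∀

  -- A level induces K_(k-1) minus an edge; below, s is the number of its vertices in A,
  -- e the number of edges of C[A] inside it, and z = 1 iff both ends of the missing
  -- edge are in A, so that 2e + 2z + s = s² and s ≤ z + (k - 2).
  level-size-cases : ∀ {s z} → z ≤ 1 → s ≤ z + (2 + n) → s ≤ 2 + n ⊎ (s ≡ m × z ≡ 1)
  level-size-cases z≤n s≤ = inj₁ s≤
  level-size-cases (s≤s z≤n) s≤ with m≤n⇒m<n∨m≡n s≤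
  ... | inj₁ s<m = inj₁ (≤-pred s<m)
  ... | inj₂ s≡m = inj₂ (s≡m , refl)

  -- Each bound below is proved after adding m (2z + s) to both sides, which turns ew e
  -- into m s² and avoids subtraction.
  ew*e+m*[2z+s]≡m*s² : ∀ s z e → 2 * e + 2 * z + s ≡ s * s → ew * e + m * (2 * z + s) ≡ m * (s * s)
  ew*e+m*[2z+s]≡m*s² s z e edges = trans (expand n e z s) (cong (_*_ m) edges)
    where
    expand : ∀ n e z s → 2 * (3 + n) * e + (3 + n) * (2 * z + s) ≡ (3 + n) * (2 * e + 2 * z + s)
    expand = solve-∀

  level-nonneg : ∀ s z e {D} → z ≤ 1 → s ≤ z + (2 + n) → 2 * e + 2 * z + s ≡ s * s →
                 D ≤ s → ew * (e + D) ≤ vw * s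
  level-nonneg s z e {D} z≤1 s≤ edges D≤s = +-cancelʳ-≤ (m * (2 * z + s)) _ _ (begin
    ew * (e + D) + m * (2 * z + s)    ≡⟨ shuffle n e D (m * (2 * z + s)) ⟩
    ew * e + m * (2 * z + s) + ew * D ≡⟨ cong (_+ ew * D) (ew*e+m*[2z+s]≡m*s² s z e edges) ⟩
    m * (s * s) + ew * D              ≤⟨ +-monoʳ-≤ (m * (s * s)) (*-monoʳ-≤ ew D≤s) ⟩
    m * (s * s) + ew * s              ≤⟨ square (level-size-cases z≤1 s≤) ⟩
    vw * s + m * (2 * z + s)          ∎)
    where
    open ≤-Reasoning
    shuffle : ∀ n e D x → 2 * (3 + n) * (e + D) + x ≡ 2 * (3 + n) * e + x + 2 * (3 + n) * D
    shuffle = solve-∀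
    square : s ≤ 2 + n ⊎ (s ≡ m × z ≡ 1) → m * (s * s) + ew * s ≤ vw * s + m * (2 * z + s)
    square (inj₁ s≤2+n) = begin
      m * (s * s) + ew * s         ≡⟨ e₁ n s ⟩
      s * (m * (1 + s)) + m * s    ≤⟨ +-monoˡ-≤ (m * s) (*-monoʳ-≤ s (m*t≤vw (s≤s s≤2+n))) ⟩
      s * vw + m * s               ≤⟨ m≤m+n _ _ ⟩
      s * vw + m * s + m * (2 * z) ≡⟨ e₂ n s z ⟩
      vw * s + m * (2 * z + s)     ∎
      where
      e₁ : ∀ n s → (3 + n) * (s * s) + 2 * (3 + n) * s ≡ s * ((3 + n) * (1 + s)) + (3 + n) * s
      e₁ = solve-∀
      e₂ : ∀ n s z → s * ((5 + n) * (2 + n)) + (3 + n) * s + (3 + n) * (2 * z)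
                   ≡ (5 + n) * (2 + n) * s + (3 + n) * (2 * z + s)
      e₂ = solve-∀
    square (inj₂ (refl , refl)) = ≤-reflexive (full n)
      where
      full : ∀ n → (3 + n) * ((3 + n) * (3 + n)) + 2 * (3 + n) * (3 + n)
                 ≡ (5 + n) * (2 + n) * (3 + n) + (3 + n) * (2 * 1 + (3 + n))
      full = solve-∀

  level-≥vw : ∀ s z e → z ≤ 1 → s ≤ z + (2 + n) → 2 * e + 2 * z + s ≡ s * s →
              1 ≤ s → vw + ew * e ≤ vw * s
  level-≥vw s z e z≤1 s≤ edges 1≤s = +-cancelʳ-≤ (m * (2 * z + s)) _ _ (begin
    vw + ew * e + m * (2 * z + s)
      ≡⟨ trans (+-assoc vw _ _) (cong (_+_ vw) (ew*e+m*[2z+s]≡m*s² s z e edges)) ⟩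
    vw + m * (s * s)              ≤⟨ square 1≤s (level-size-cases z≤1 s≤) ⟩
    vw * s + m * (2 * z + s)      ∎)
    where
    open ≤-Reasoning
    square : 1 ≤ s → s ≤ 2 + n ⊎ (s ≡ m × z ≡ 1) → vw + m * (s * s) ≤ vw * s + m * (2 * z + s)
    square (s≤s {n = s′} _) (inj₁ s≤2+n) = begin
      vw + m * (suc s′ * suc s′)                   ≡⟨ e₁ n s′ ⟩
      s′ * (m * (1 + s′)) + (vw + m * (1 + s′))
        ≤⟨ +-monoˡ-≤ _ (*-monoʳ-≤ s′ (m*t≤vw (m≤n⇒m≤1+n s≤2+n))) ⟩
      s′ * vw + (vw + m * (1 + s′))                ≤⟨ m≤m+n _ _ ⟩
      s′ * vw + (vw + m * (1 + s′)) + m * (2 * z)  ≡⟨ e₂ n s′ z ⟩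
      vw * suc s′ + m * (2 * z + suc s′)           ∎
      where
      e₁ : ∀ n s → (5 + n) * (2 + n) + (3 + n) * (suc s * suc s)
                 ≡ s * ((3 + n) * (1 + s)) + ((5 + n) * (2 + n) + (3 + n) * (1 + s))
      e₁ = solve-∀
      e₂ : ∀ n s z → s * ((5 + n) * (2 + n)) + ((5 + n) * (2 + n) + (3 + n) * (1 + s))
                     + (3 + n) * (2 * z)
                   ≡ (5 + n) * (2 + n) * suc s + (3 + n) * (2 * z + suc s)
      e₂ = solve-∀
    square _ (inj₂ (refl , refl)) = m+o≡n⇒m≤n (full n)
      where
      full : ∀ n → (5 + n) * (2 + n) + (3 + n) * ((3 + n) * (3 + n)) + (n * n + 5 * n + 8)
                 ≡ (5 + n) * (2 + n) * (3 + n) + (3 + n) * (2 * 1 + (3 + n))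
      full = solve-∀

  level-≥2vw-ew : ∀ s z e → z ≤ 1 → s ≤ z + (2 + n) → 2 * e + 2 * z + s ≡ s * s →
                  2 ≤ s → 2 * vw + ew * e ≤ vw * s + ew
  level-≥2vw-ew s z e z≤1 s≤ edges 2≤s = +-cancelʳ-≤ (m * (2 * z + s)) _ _ (begin
    2 * vw + ew * e + m * (2 * z + s)
      ≡⟨ trans (+-assoc (2 * vw) _ _) (cong (_+_ (2 * vw)) (ew*e+m*[2z+s]≡m*s² s z e edges)) ⟩
    2 * vw + m * (s * s)              ≤⟨ square 2≤s (level-size-cases z≤1 s≤) ⟩
    vw * s + ew + m * (2 * z + s)     ∎)
    where
    open ≤-Reasoning
    square : 2 ≤ s → s ≤ 2 + n ⊎ (s ≡ m × z ≡ 1) →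
             2 * vw + m * (s * s) ≤ vw * s + ew + m * (2 * z + s)
    square (s≤s (s≤s {n = s′} _)) (inj₁ s≤2+n) = begin
      2 * vw + m * ((2 + s′) * (2 + s′))                 ≡⟨ e₁ n s′ ⟩
      s′ * (m * (3 + s′)) + (2 * vw + m * (4 + s′))
        ≤⟨ +-monoˡ-≤ _ (*-monoʳ-≤ s′ (m*t≤vw (s≤s s≤2+n))) ⟩
      s′ * vw + (2 * vw + m * (4 + s′))                  ≤⟨ m≤m+n _ _ ⟩
      s′ * vw + (2 * vw + m * (4 + s′)) + m * (2 * z)    ≡⟨ e₂ n s′ z ⟩
      vw * (2 + s′) + ew + m * (2 * z + (2 + s′))        ∎
      where
      e₁ : ∀ n s → 2 * ((5 + n) * (2 + n)) + (3 + n) * ((2 + s) * (2 + s))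
                 ≡ s * ((3 + n) * (3 + s)) + (2 * ((5 + n) * (2 + n)) + (3 + n) * (4 + s))
      e₁ = solve-∀
      e₂ : ∀ n s z → s * ((5 + n) * (2 + n)) + (2 * ((5 + n) * (2 + n)) + (3 + n) * (4 + s))
                     + (3 + n) * (2 * z)
                   ≡ (5 + n) * (2 + n) * (2 + s) + 2 * (3 + n) + (3 + n) * (2 * z + (2 + s))
      e₂ = solve-∀
    square _ (inj₂ (refl , refl)) = m+o≡n⇒m≤n (full n)
      where
      full : ∀ n → 2 * ((5 + n) * (2 + n)) + (3 + n) * ((3 + n) * (3 + n)) + 4
                 ≡ (5 + n) * (2 + n) * (3 + n) + 2 * (3 + n) + (3 + n) * (2 * 1 + (3 + n))
      full = solve-∀

  private
    vw+m*s²+m*2D≤vw*s+ew+m*[2z+s] : ∀ {s z D} → 1 ≤ s → s ≤ 2 + n ⊎ (s ≡ m × z ≡ 1) → D ≤ s →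
      2 * D ≤ z + m → vw + m * (s * s) + m * (2 * D) ≤ vw * s + ew + m * (2 * z + s)
    vw+m*s²+m*2D≤vw*s+ew+m*[2z+s] {suc s′} {z} {D} _ (inj₁ s≤2+n) D≤s 2D≤
      with m≤n⇒m<n∨m≡n s≤2+n
    ... | inj₁ (s≤s (s≤s s′≤n)) = begin
      vw + m * (suc s′ * suc s′) + m * (2 * D)         ≤⟨ +-monoʳ-≤ (vw + m * (suc s′ * suc s′))
                                                            (*-monoʳ-≤ m (*-monoʳ-≤ 2 D≤s)) ⟩
      vw + m * (suc s′ * suc s′) + m * (2 * suc s′)    ≡⟨ e₁ n s′ ⟩
      s′ * (m * (3 + s′)) + (vw + ew + m * (1 + s′))   ≤⟨ +-monoˡ-≤ _ (*-monoʳ-≤ s′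
                                                            (m*t≤vw (+-monoʳ-≤ 3 s′≤n))) ⟩
      s′ * vw + (vw + ew + m * (1 + s′))               ≤⟨ m≤m+n _ _ ⟩
      s′ * vw + (vw + ew + m * (1 + s′)) + m * (2 * z) ≡⟨ e₂ n s′ z ⟩
      vw * suc s′ + ew + m * (2 * z + suc s′)          ∎
      where
      open ≤-Reasoning
      e₁ : ∀ n s → (5 + n) * (2 + n) + (3 + n) * (suc s * suc s) + (3 + n) * (2 * suc s)
                 ≡ s * ((3 + n) * (3 + s)) + ((5 + n) * (2 + n) + 2 * (3 + n) + (3 + n) * (1 + s))
      e₁ = solve-∀
      e₂ : ∀ n s z → s * ((5 + n) * (2 + n)) + ((5 + n) * (2 + n) + 2 * (3 + n) + (3 + n) * (1 + s))
                     + (3 + n) * (2 * z)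
                   ≡ (5 + n) * (2 + n) * suc s + 2 * (3 + n) + (3 + n) * (2 * z + suc s)
      e₂ = solve-∀
    ... | inj₂ refl = begin
      vw + m * ((2 + n) * (2 + n)) + m * (2 * D)       ≤⟨ +-monoʳ-≤ (vw + m * ((2 + n) * (2 + n)))
                                                            (*-monoʳ-≤ m 2D≤) ⟩
      vw + m * ((2 + n) * (2 + n)) + m * (z + m)       ≤⟨ m+o≡n⇒m≤n (almost-full n z) ⟩
      vw * (2 + n) + ew + m * (2 * z + (2 + n))        ∎
      where
      open ≤-Reasoning
      almost-full : ∀ n z → (5 + n) * (2 + n) + (3 + n) * ((2 + n) * (2 + n)) + (3 + n) * (z + (3 + n))
                            + ((1 + n) * (1 + n) + (3 + n) * z)
                          ≡ (5 + n) * (2 + n) * (2 + n) + 2 * (3 + n) + (3 + n) * (2 * z + (2 + n))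
      almost-full = solve-∀
    vw+m*s²+m*2D≤vw*s+ew+m*[2z+s] {D = D} _ (inj₂ (refl , refl)) _ 2D≤ = begin
      vw + m * (m * m) + m * (2 * D)   ≤⟨ +-monoʳ-≤ (vw + m * (m * m)) (*-monoʳ-≤ m 2D≤) ⟩
      vw + m * (m * m) + m * (1 + m)   ≤⟨ m+o≡n⇒m≤n (full n) ⟩
      vw * m + ew + m * (2 * 1 + m)    ∎
      where
      open ≤-Reasoning
      full : ∀ n → (5 + n) * (2 + n) + (3 + n) * ((3 + n) * (3 + n)) + (3 + n) * (1 + (3 + n)) + 2
                 ≡ (5 + n) * (2 + n) * (3 + n) + 2 * (3 + n) + (3 + n) * (2 * 1 + (3 + n))
      full = solve-∀

  level-≥vw-ew : ∀ s z e {D} → z ≤ 1 → s ≤ z + (2 + n) → 2 * e + 2 * z + s ≡ s * s →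
                 1 ≤ s → D ≤ s → 2 * D ≤ z + m → vw + ew * (e + D) ≤ vw * s + ew
  level-≥vw-ew s z e {D} z≤1 s≤ edges 1≤s D≤s 2D≤ = +-cancelʳ-≤ (m * (2 * z + s)) _ _ (begin
    vw + ew * (e + D) + m * (2 * z + s)
      ≡⟨ shuffle n e D (m * (2 * z + s)) ⟩
    vw + (ew * e + m * (2 * z + s)) + m * (2 * D)
      ≡⟨ cong (λ x → vw + x + m * (2 * D)) (ew*e+m*[2z+s]≡m*s² s z e edges) ⟩
    vw + m * (s * s) + m * (2 * D)
      ≤⟨ vw+m*s²+m*2D≤vw*s+ew+m*[2z+s] 1≤s (level-size-cases z≤1 s≤) D≤s 2D≤ ⟩
    vw * s + ew + m * (2 * z + s) ∎)
    where
    open ≤-Reasoning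
    shuffle : ∀ n e D x → (5 + n) * (2 + n) + 2 * (3 + n) * (e + D) + x
                        ≡ (5 + n) * (2 + n) + (2 * (3 + n) * e + x) + (3 + n) * (2 * D)
    shuffle = solve-∀

  φ : ℕ → ℕ → ℤ
  φ s c = + (vw * s) - + (ew * c)

  φ-+ : ∀ s s′ c c′ → φ (s + s′) (c + c′) ≡ φ s c ℤ.+ φ s′ c′
  φ-+ s s′ c c′ = begin
    + (vw * (s + s′)) - + (ew * (c + c′))
      ≡⟨ cong₂ (λ x y → + x - + y) (*-distribˡ-+ vw s s′) (*-distribˡ-+ ew c c′) ⟩
    + (vw * s + vw * s′) - + (ew * c + ew * c′)
      ≡⟨ cong₂ _-_ (ℤ.pos-+ (vw * s) (vw * s′)) (ℤ.pos-+ (ew * c) (ew * c′)) ⟩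
    (+ (vw * s) ℤ.+ + (vw * s′)) - (+ (ew * c) ℤ.+ + (ew * c′))
      ≡⟨ regroup (+ (vw * s)) (+ (vw * s′)) (+ (ew * c)) (+ (ew * c′)) ⟩
    φ s c ℤ.+ φ s′ c′ ∎
    where
    open ≡-Reasoning
    regroup : ∀ a b c d → (a ℤ.+ b) - (c ℤ.+ d) ≡ (a - c) ℤ.+ (b - d)
    regroup = solve-∀ℤ

  φ-≥ : ∀ p q s c → p + ew * c ≤ vw * s + q → + p - + q ℤ.≤ φ s c
  φ-≥ p q s c = p+s≤r+q⇒p-q≤r-s {p} {q} {vw * s} {ew * c}

  φ-≥₀ : ∀ p s c → p + ew * c ≤ vw * s → + p ℤ.≤ φ s c
  φ-≥₀ p s c h =
    subst (ℤ._≤ φ s c) (ℤ.+-identityʳ (+ p))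
          (φ-≥ p 0 s c (subst (p + ew * c ≤_) (sym (+-identityʳ _)) h))

  φ-0 : φ 0 0 ≡ 0ℤ
  φ-0 = cong₂ (λ x y → + x - + y) (*-zeroʳ vw) (*-zeroʳ ew)

  -- The bounds proved for the potential x of a piece of the complex that has s vertices in A
  -- and hangs below two attachment vertices, j of which are in A.
  PotentialBound : ℕ → ℕ → ℤ → Set
  PotentialBound 0 s x =
    0ℤ ℤ.≤ x × (1 ≤ s → + vw ℤ.≤ x) × (2 ≤ s → + (2 * vw) - + ew ℤ.≤ x)
  PotentialBound 1 s x = 0ℤ ℤ.≤ x × (1 ≤ s → + vw - + ew ℤ.≤ x)
  PotentialBound (suc (suc _)) s x = 0ℤ ℤ.≤ x

  bound-nonneg : ∀ j {s x} → PotentialBound j s x → 0ℤ ℤ.≤ x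
  bound-nonneg 0 (h , _) = h
  bound-nonneg 1 (h , _) = h
  bound-nonneg (suc (suc _)) h = h

  bound-≤1 : ∀ {j s x} → j ≤ 1 → PotentialBound j s x → 1 ≤ s → + vw - + ew ℤ.≤ x
  bound-≤1 z≤n (_ , h , _) 1≤s = ℤ.≤-trans (ℤ.i-j≤i (+ vw) (+ ew)) (h 1≤s)
  bound-≤1 (s≤s z≤n) (_ , h) 1≤s = h 1≤s

  bound-empty : ∀ j → PotentialBound j 0 0ℤ
  bound-empty 0 = ℤ.≤-refl , (λ ()) , (λ ())
  bound-empty 1 = ℤ.≤-refl , (λ ())
  bound-empty (suc (suc _)) = ℤ.≤-refl

  2vw-ew≤vw+[vw-ew] : ∀ {x y} → + vw ℤ.≤ x → + vw - + ew ℤ.≤ y →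
                      + (2 * vw) - + ew ℤ.≤ x ℤ.+ y
  2vw-ew≤vw+[vw-ew] h h′ = subst (ℤ._≤ _) (double vw ew) (ℤ.+-mono-≤ h h′)
    where
    double : ∀ a b → + a ℤ.+ (+ a - + b) ≡ + (2 * a) - + b
    double a b = trans (e (+ a) (+ b)) (cong (_- + b) (sym (ℤ.pos-+ a (a + 0))))
      where
      e : ∀ a b → a ℤ.+ (a - b) ≡ (a ℤ.+ (a ℤ.+ + 0)) - b
      e = solve-∀ℤ

  bound-parallel : ∀ j {s s′ x y} → PotentialBound j s x → PotentialBound j s′ y →
                   PotentialBound j (s + s′) (x ℤ.+ y)
  bound-parallel 0 {zero} (h , _) (h′ , h′₁ , h′₂) =
    ≤-+-nonnegʳ h h′ , ≤-+-nonnegˡ h ∘ h′₁ , ≤-+-nonnegˡ h ∘ h′₂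
  bound-parallel 0 {suc zero} (h , h₁ , _) (h′ , h′₁ , h′₂) =
    ≤-+-nonnegʳ h h′ , (λ _ → ≤-+-nonnegʳ (h₁ (s≤s z≤n)) h′) ,
    λ { (s≤s 1≤s′) → 2vw-ew≤vw+[vw-ew] (h₁ (s≤s z≤n)) (bound-≤1 z≤n (h′ , h′₁ , h′₂) 1≤s′) }
  bound-parallel 0 {suc (suc _)} (h , h₁ , h₂) (h′ , _) =
    ≤-+-nonnegʳ h h′ , (λ _ → ≤-+-nonnegʳ (h₁ (s≤s z≤n)) h′) ,
    (λ _ → ≤-+-nonnegʳ (h₂ (s≤s (s≤s z≤n))) h′)
  bound-parallel 1 {zero} (h , _) (h′ , h′₁) = ≤-+-nonnegʳ h h′ , ≤-+-nonnegˡ h ∘ h′₁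
  bound-parallel 1 {suc _} (h , h₁) (h′ , _) =
    ≤-+-nonnegʳ h h′ , (λ _ → ≤-+-nonnegʳ (h₁ (s≤s z≤n)) h′)
  bound-parallel (suc (suc _)) h h′ = ≤-+-nonnegʳ h h′

  -- The attachment vertices of the lower piece lie in the upper one, whence j′ ≤ s.
  bound-series : ∀ j {j′ s S x y} → j′ ≤ s → PotentialBound j s x → PotentialBound j′ S y →
                 PotentialBound j (s + S) (x ℤ.+ y)
  bound-series 0 {s = zero} z≤n (h , _) (h′ , h′₁ , h′₂) =
    ≤-+-nonnegʳ h h′ , ≤-+-nonnegˡ h ∘ h′₁ , ≤-+-nonnegˡ h ∘ h′₂
  bound-series 0 {j′} {s = suc zero} j′≤1 (h , h₁ , _) h′ =
    ≤-+-nonnegʳ h y≥0 , (λ _ → ≤-+-nonnegʳ (h₁ (s≤s z≤n)) y≥0) ,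
    λ { (s≤s 1≤S) → 2vw-ew≤vw+[vw-ew] (h₁ (s≤s z≤n)) (bound-≤1 j′≤1 h′ 1≤S) }
    where y≥0 = bound-nonneg j′ h′
  bound-series 0 {j′} {s = suc (suc _)} _ (h , h₁ , h₂) h′ =
    ≤-+-nonnegʳ h y≥0 , (λ _ → ≤-+-nonnegʳ (h₁ (s≤s z≤n)) y≥0) ,
    (λ _ → ≤-+-nonnegʳ (h₂ (s≤s (s≤s z≤n))) y≥0)
    where y≥0 = bound-nonneg j′ h′
  bound-series 1 {s = zero} z≤n (h , _) (h′ , h′₁ , _) =
    ≤-+-nonnegʳ h h′ , λ 1≤S → ≤-+-nonnegˡ h (ℤ.≤-trans (ℤ.i-j≤i (+ vw) (+ ew)) (h′₁ 1≤S))
  bound-series 1 {j′} {s = suc _} _ (h , h₁) h′ =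
    ≤-+-nonnegʳ h y≥0 , (λ _ → ≤-+-nonnegʳ (h₁ (s≤s z≤n)) y≥0)
    where y≥0 = bound-nonneg j′ h′
  bound-series (suc (suc _)) {j′} _ h h′ = ≤-+-nonnegʳ h (bound-nonneg j′ h′)

  -- x_b says whether the attachment vertex of side b is in A, and d_b counts the vertices of
  -- the level in A joined to it.
  level-bound : ∀ x₀ x₁ {s z e d₀ d₁} → z ≤ 1 → s ≤ z + (2 + n) → 2 * e + 2 * z + s ≡ s * s →
                d₀ + d₁ ≤ s → 2 * d₀ ≤ z + m → 2 * d₁ ≤ m →
                PotentialBound (ι x₀ + ι x₁) s
                  (φ s (e + ((if x₀ then d₀ else 0) + (if x₁ then d₁ else 0))))
  level-bound false false {s} {z} {e} z≤1 s≤ edges _ _ _ =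
    φ-≥₀ 0 s (e + 0) (level-nonneg s z e z≤1 s≤ edges z≤n) ,
    +0 (φ-≥₀ vw s e ∘ level-≥vw s z e z≤1 s≤ edges) ,
    +0 (φ-≥ (2 * vw) ew s e ∘ level-≥2vw-ew s z e z≤1 s≤ edges)
    where
    +0 : ∀ {P : Set} {β} → (P → β ℤ.≤ φ s e) → P → β ℤ.≤ φ s (e + 0)
    +0 {β = β} h p = subst (λ c → β ℤ.≤ φ s c) (sym (+-identityʳ e)) (h p)
  level-bound true false {s} {z} {e} {d₀} z≤1 s≤ edges d≤s 2d₀≤ _ =
    φ-≥₀ 0 s (e + _) (level-nonneg s z e z≤1 s≤ edges d₀≤s) ,
    λ 1≤s → φ-≥ vw ew s (e + _) (level-≥vw-ew s z e z≤1 s≤ edges 1≤s d₀≤s 2d₀+0≤)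
    where
    d₀≤s = ≤-trans (+-monoʳ-≤ d₀ z≤n) d≤s
    2d₀+0≤ = subst (λ d → 2 * d ≤ z + m) (sym (+-identityʳ d₀)) 2d₀≤
  level-bound false true {s} {z} {e} {d₀} z≤1 s≤ edges d≤s _ 2d₁≤ =
    φ-≥₀ 0 s (e + _) (level-nonneg s z e z≤1 s≤ edges d₁≤s) ,
    λ 1≤s → φ-≥ vw ew s (e + _) (level-≥vw-ew s z e z≤1 s≤ edges 1≤s d₁≤s (m≤n⇒m≤o+n z 2d₁≤))
    where d₁≤s = m+n≤o⇒n≤o d₀ d≤s
  level-bound true true {s} {z} {e} z≤1 s≤ edges d≤s _ _ =
    φ-≥₀ 0 s (e + _) (level-nonneg s z e z≤1 s≤ edges d≤s)

  φ-+-vertices : ∀ a S C → φ (a + S) C ≡ + (vw * a) ℤ.+ φ S C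
  φ-+-vertices a S C = trans (φ-+ a S 0 C) (cong (ℤ._+ φ S C) no-edges)
    where
    no-edges : φ a 0 ≡ + (vw * a)
    no-edges = trans (cong (λ x → + (vw * a) - + x) (*-zeroʳ ew)) (ℤ.+-identityʳ (+ (vw * a)))

  2vw-ew≤φ[1+S] : ∀ {S C} → (1 ≤ S → + vw - + ew ℤ.≤ φ S C) →
                  2 ≤ suc S → + (2 * vw) - + ew ℤ.≤ φ (suc S) C
  2vw-ew≤φ[1+S] {S} {C} h (s≤s 1≤S) = subst (_ ℤ.≤_) (sym (φ-+-vertices 1 S C))
    (2vw-ew≤vw+[vw-ew] (ℤ.≤-reflexive (cong +_ (sym (*-identityʳ vw)))) (h 1≤S))

  bound-with-base : ∀ x₀ x₁ {S C} → PotentialBound (ι x₀ + ι x₁) S (φ S C) →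
                    (2 ≤ ι x₀ + (ι x₁ + S) → + (2 * vw) - + ew ℤ.≤ φ (ι x₀ + (ι x₁ + S)) C)
                    × (x₀ ≡ true → x₁ ≡ true → + (2 * vw) ℤ.≤ φ (ι x₀ + (ι x₁ + S)) C)
  bound-with-base true true {S} {C} h =
    (λ _ → ℤ.≤-trans (ℤ.i-j≤i (+ (2 * vw)) (+ ew)) both) , λ _ _ → both
    where
    both : + (2 * vw) ℤ.≤ φ (2 + S) C
    both = subst (_ ℤ.≤_) (sym (φ-+-vertices 2 S C))
                 (≤-+-nonnegʳ (ℤ.≤-reflexive (cong +_ (*-comm 2 vw))) h)
  bound-with-base true false {S} {C} (_ , h) = 2vw-ew≤φ[1+S] {S} {C} h , λ _ ()
  bound-with-base false true {S} {C} (_ , h) = 2vw-ew≤φ[1+S] {S} {C} h , λ ()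
  bound-with-base false false (_ , _ , h) = h , λ ()

module EdgeCounting {V : Set} (A : V → Bool) (E : V → V → Bool) where

  deg : V → List V → ℕ
  deg u = count (λ v → A v ∧ E u v)

  edges : List V → ℕ
  edges xs = count (uncurry E) (pairs (filterB A xs))

  between : List V → List V → ℕ
  between [] ys = 0
  between (u ∷ xs) ys = (if A u then deg u ys else 0) + between xs ys

  between-[]ʳ : ∀ xs → between xs [] ≡ 0
  between-[]ʳ [] = refl
  between-[]ʳ (u ∷ xs) with A u
  ... | true = between-[]ʳ xs
  ... | false = between-[]ʳ xs

  cost : List V → List V → ℕ
  cost ps xs = edges xs + between ps xs

  edges-∷ : ∀ u xs → edges (u ∷ xs) ≡ (if A u then deg u xs else 0) + edges xs
  edges-∷ u xs with A u
  ... | false = refl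
  ... | true = begin
    count (uncurry E) (map (u ,_) (filterB A xs) ++ pairs (filterB A xs))
      ≡⟨ count-++ (uncurry E) (map (u ,_) (filterB A xs)) _ ⟩
    count (uncurry E) (map (u ,_) (filterB A xs)) + edges xs
      ≡⟨ cong (_+ edges xs) (trans (count-map (uncurry E) (u ,_) (filterB A xs))
                                   (count-filterB (E u) A xs)) ⟩
    deg u xs + edges xs ∎
    where open ≡-Reasoning

  between-++ˡ : ∀ xs xs′ ys → between (xs ++ xs′) ys ≡ between xs ys + between xs′ ys
  between-++ˡ [] xs′ ys = refl
  between-++ˡ (u ∷ xs) xs′ ys =
    trans (cong (_+_ d) (between-++ˡ xs xs′ ys)) (sym (+-assoc d (between xs ys) (between xs′ ys)))
    where d = if A u then deg u ys else 0

  between-++ʳ : ∀ xs ys ys′ → between xs (ys ++ ys′) ≡ between xs ys + between xs ys′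
  between-++ʳ [] ys ys′ = refl
  between-++ʳ (u ∷ xs) ys ys′ = begin
    (if A u then deg u (ys ++ ys′) else 0) + between xs (ys ++ ys′)
      ≡⟨ cong₂ _+_ (trans (cong (if A u then_else 0) (count-++ _ ys ys′)) (if-+ (A u) _ _))
                   (between-++ʳ xs ys ys′) ⟩
    ((if A u then deg u ys else 0) + (if A u then deg u ys′ else 0)) + (between xs ys + between xs ys′)
      ≡⟨ interchange (if A u then deg u ys else 0) _ _ _ ⟩
    ((if A u then deg u ys else 0) + between xs ys)
      + ((if A u then deg u ys′ else 0) + between xs ys′) ∎
    where open ≡-Reasoning

  edges-++ : ∀ xs ys → edges (xs ++ ys) ≡ edges xs + edges ys + between xs ys
  edges-++ [] ys = sym (+-identityʳ (edges ys))
  edges-++ (u ∷ xs) ys = begin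
    edges (u ∷ xs ++ ys)
      ≡⟨ edges-∷ u (xs ++ ys) ⟩
    (if A u then deg u (xs ++ ys) else 0) + edges (xs ++ ys)
      ≡⟨ cong₂ _+_ (trans (cong (if A u then_else 0) (count-++ _ xs ys)) (if-+ (A u) _ _))
                   (edges-++ xs ys) ⟩
    ((if A u then deg u xs else 0) + (if A u then deg u ys else 0)) + (edges xs + edges ys + between xs ys)
      ≡⟨ regroup (if A u then deg u xs else 0) _ (edges xs) _ _ ⟩
    ((if A u then deg u xs else 0) + edges xs) + edges ys + ((if A u then deg u ys else 0) + between xs ys)
      ≡⟨ cong (λ x → x + edges ys + between (u ∷ xs) ys) (sym (edges-∷ u xs)) ⟩
    edges (u ∷ xs) + edges ys + between (u ∷ xs) ys ∎
    where
    open ≡-Reasoning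
    regroup : ∀ a b c d e → (a + b) + (c + d + e) ≡ (a + c) + d + (b + e)
    regroup = solve-∀

  cost-++ : ∀ ps xs ys → cost ps (xs ++ ys) ≡ cost ps xs + cost ps ys + between xs ys
  cost-++ ps xs ys = begin
    edges (xs ++ ys) + between ps (xs ++ ys)
      ≡⟨ cong₂ _+_ (edges-++ xs ys) (between-++ʳ ps xs ys) ⟩
    edges xs + edges ys + between xs ys + (between ps xs + between ps ys)
      ≡⟨ regroup (edges xs) (edges ys) (between xs ys) (between ps xs) (between ps ys) ⟩
    cost ps xs + cost ps ys + between xs ys ∎
    where
    open ≡-Reasoning
    regroup : ∀ a b c d e → a + b + c + (d + e) ≡ (a + d) + (b + e) + c
    regroup = solve-∀

  deg-none : ∀ {u xs} → All (λ v → E u v ≡ false) xs → deg u xs ≡ 0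
  deg-none [] = refl
  deg-none {u} {v ∷ xs} (Euv ∷ rest) rewrite Euv | ∧-zeroʳ (A v) = deg-none rest

  deg-all : ∀ {u xs} → All (λ v → E u v ≡ true) xs → deg u xs ≡ count A xs
  deg-all [] = refl
  deg-all {u} {v ∷ xs} (Euv ∷ rest) rewrite Euv | ∧-identityʳ (A v) with A v
  ... | true = cong suc (deg-all rest)
  ... | false = deg-all rest

  between-none : ∀ {xs ys} → All (λ u → All (λ v → E u v ≡ false) ys) xs → between xs ys ≡ 0
  between-none [] = refl
  between-none {u ∷ xs} (u∉ ∷ rest) rewrite deg-none u∉ | between-none rest with A u
  ... | true = refl
  ... | false = refl

  clique-edges : ∀ {xs} → AllPairs (λ u v → E u v ≡ true) xs →
                 2 * edges xs + count A xs ≡ count A xs * count A xs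
  clique-edges [] = refl
  clique-edges {u ∷ xs} (u~xs ∷ xs!) rewrite edges-∷ u xs | deg-all u~xs with A u
  ... | false = clique-edges xs!
  ... | true = clique-step (count A xs) (edges xs) (clique-edges xs!)

  clique-minus-edge-edges :
    ∀ {u₀ u₁ R} → E u₀ u₁ ≡ false → All (λ v → E u₀ v ≡ true) R →
    All (λ v → E u₁ v ≡ true) R → AllPairs (λ u v → E u v ≡ true) R →
    2 * edges (u₀ ∷ u₁ ∷ R) + 2 * ι (A u₀ ∧ A u₁) + count A (u₀ ∷ u₁ ∷ R)
      ≡ count A (u₀ ∷ u₁ ∷ R) * count A (u₀ ∷ u₁ ∷ R)
  clique-minus-edge-edges {u₀} {u₁} {R} u₀≁u₁ u₀~R u₁~R R!
    rewrite edges-∷ u₀ (u₁ ∷ R) | edges-∷ u₁ R | count-∷ A u₀ (u₁ ∷ R) | count-∷ A u₁ R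
          | count-∷ (λ v → A v ∧ E u₀ v) u₁ R | u₀≁u₁ | ∧-zeroʳ (A u₁)
          | deg-all u₀~R | deg-all u₁~R
    = two-vertices (A u₀) (A u₁) (count A R) (edges R) (clique-edges R!)
    where
    two-vertices : ∀ a b r e → 2 * e + r ≡ r * r →
      2 * ((if a then r else 0) + ((if b then r else 0) + e)) + 2 * ι (a ∧ b) + (ι a + (ι b + r))
        ≡ (ι a + (ι b + r)) * (ι a + (ι b + r))
    two-vertices false false r e eq = trans (cong (_+ r) (+-identityʳ (2 * e))) eq
    two-vertices true false r e eq = trans (cong (_+ suc r) (+-identityʳ _)) (clique-step r e eq)
    two-vertices false true r e eq = trans (cong (_+ suc r) (+-identityʳ _)) (clique-step r e eq)
    two-vertices true true r e eq = trans (shift r e) (clique-step (suc r) (r + e) (clique-step r e eq))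
      where
      shift : ∀ r e → 2 * (r + (r + e)) + 2 * 1 + (2 + r) ≡ 2 * (suc r + (r + e)) + suc (suc r)
      shift = solve-∀

module Pieces (n : ℕ) {V : Set} (A : V → Bool) (E : V → V → Bool) where
  open Potential n
  open EdgeCounting A E

  PieceBound : List V → List V → Set
  PieceBound ps xs = PotentialBound (count A ps) (count A xs) (φ (count A xs) (cost ps xs))

  piece-[] : ∀ ps → PieceBound ps []
  piece-[] ps = subst (PotentialBound (count A ps) 0) (sym (trans (cong (φ 0) (between-[]ʳ ps)) φ-0))
                      (bound-empty (count A ps))

  φ-++ : ∀ ps {xs ys c c′} → cost ps (xs ++ ys) ≡ c + c′ →
         φ (count A (xs ++ ys)) (cost ps (xs ++ ys)) ≡ φ (count A xs) c ℤ.+ φ (count A ys) c′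
  φ-++ ps {xs} {ys} {c} {c′} cost≡ =
    trans (cong₂ φ (count-++ A xs ys) cost≡) (φ-+ (count A xs) (count A ys) c c′)

  piece-parallel : ∀ ps {xs ys} → between xs ys ≡ 0 → PieceBound ps xs → PieceBound ps ys →
                   PieceBound ps (xs ++ ys)
  piece-parallel ps {xs} {ys} no-edges bx by =
    subst₂ (PotentialBound (count A ps)) (sym (count-++ A xs ys))
           (sym (φ-++ ps {xs} {ys} {cost ps xs} {cost ps ys} cost≡))
           (bound-parallel (count A ps) bx by)
    where
    cost≡ : cost ps (xs ++ ys) ≡ cost ps xs + cost ps ys
    cost≡ = trans (cost-++ ps xs ys)
                  (trans (cong (_+_ (cost ps xs + cost ps ys)) no-edges) (+-identityʳ _))

  piece-series : ∀ ps qs {xs ys} → count A qs ≤ count A xs →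
                 cost ps (xs ++ ys) ≡ cost ps xs + cost qs ys →
                 PotentialBound (count A ps) (count A xs) (φ (count A xs) (cost ps xs)) →
                 PieceBound qs ys → PieceBound ps (xs ++ ys)
  piece-series ps qs {xs} {ys} qs≤xs cost≡ bx by =
    subst₂ (PotentialBound (count A ps)) (sym (count-++ A xs ys))
           (sym (φ-++ ps {xs} {ys} {cost ps xs} {cost qs ys} cost≡))
           (bound-series (count A ps) qs≤xs bx by)

sample : ∀ {N} → (ℕ → Bool) → ℕ → Fin N → Bool
sample f r j = f (2 * toℕ j + r)

count-sample-suc : ∀ N (f : ℕ → Bool) r →
  count (sample f r) (allFin (suc N)) ≡ ι (f r) + count (sample f (2 + r)) (allFin N)
count-sample-suc N f r = begin
  count (sample f r) (allFin (suc N))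
    ≡⟨ count-∷ (sample f r) zero (tabulate (suc {N})) ⟩
  ι (f r) + count (sample {suc N} f r) (tabulate suc)
    ≡⟨ cong (_+_ (ι (f r))) (trans (count-tabulate (sample f r) (suc {N}))
                                   (count-cong (allFin N) (λ j → cong f (shift (toℕ j) r)))) ⟩
  ι (f r) + count (sample f (2 + r)) (allFin N) ∎
  where
  open ≡-Reasoning
  shift : ∀ x r → 2 * suc x + r ≡ 2 * x + (2 + r)
  shift = solve-∀

count-sample-below : ∀ N r M → 2 * count (sample (_≤ᵇ M) r) (allFin N) ≤ (2 + M) ∸ r
count-sample-below zero r M = z≤n
count-sample-below (suc N) r M = begin
  2 * count (sample (_≤ᵇ M) r) (allFin (suc N)) ≡⟨ cong (2 *_) (count-sample-suc N (_≤ᵇ M) r) ⟩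
  2 * (ι (r ≤ᵇ M) + c)                         ≤⟨ step (r ≤ᵇ M) (≤ᵇ⇒≤ r M) ⟩
  (2 + M) ∸ r                                  ∎
  where
  open ≤-Reasoning
  c = count (sample (_≤ᵇ M) (2 + r)) (allFin N)
  step : ∀ b → (T b → r ≤ M) → 2 * (ι b + c) ≤ (2 + M) ∸ r
  step true r≤M = begin
    2 * suc c     ≡⟨ *-suc 2 c ⟩
    2 + 2 * c     ≤⟨ +-monoʳ-≤ 2 (count-sample-below N (2 + r) M) ⟩
    2 + (M ∸ r)   ≡⟨ sym (+-∸-assoc 2 (r≤M _)) ⟩
    (2 + M) ∸ r   ∎
  step false _ = ≤-trans (count-sample-below N (2 + r) M) (∸-monoˡ-≤ r (m≤n+m M 2))

count-sample-above : ∀ N r M → 2 * count (sample (M ≤ᵇ_) r) (allFin N) ≤ (2 * N + r) ∸ M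
count-sample-above zero r M = z≤n
count-sample-above (suc N) r M = begin
  2 * count (sample (M ≤ᵇ_) r) (allFin (suc N)) ≡⟨ cong (2 *_) (count-sample-suc N (M ≤ᵇ_) r) ⟩
  2 * (ι (M ≤ᵇ r) + c)                         ≤⟨ step (M ≤ᵇ r) (≤ᵇ⇒≤ M r) ⟩
  (2 * suc N + r) ∸ M                          ∎
  where
  open ≤-Reasoning
  c = count (sample (M ≤ᵇ_) (2 + r)) (allFin N)
  step : ∀ b → (T b → M ≤ r) → 2 * (ι b + c) ≤ (2 * suc N + r) ∸ M
  step true M≤r = begin
    2 * suc c               ≤⟨ *-monoʳ-≤ 2 (s≤s (≤-trans (count-≤-length _ (allFin N))
                                                         (≤-reflexive (length-tabulate id)))) ⟩
    2 * suc N               ≤⟨ m≤m+n _ _ ⟩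
    2 * suc N + (r ∸ M)     ≡⟨ sym (+-∸-assoc (2 * suc N) (M≤r _)) ⟩
    (2 * suc N + r) ∸ M     ∎
  step false _ = begin
    2 * c                   ≤⟨ count-sample-above N (2 + r) M ⟩
    (2 * N + (2 + r)) ∸ M   ≡⟨ cong (_∸ M) (shift N r) ⟩
    (2 * suc N + r) ∸ M     ∎
    where
    shift : ∀ N r → 2 * N + (2 + r) ≡ 2 * suc N + r
    shift = solve-∀

indices≥2 : ∀ N → List (Fin (2 + N))
indices≥2 N = tabulate (2 ↑ʳ_)

count-allFin-2+ : ∀ {N} (p : Fin (2 + N) → Bool) →
  count p (allFin (2 + N)) ≡ ι (p zero) + (ι (p (suc zero)) + count p (indices≥2 N))
count-allFin-2+ {N} p =
  trans (count-∷ p zero (tabulate (suc {1 + N})))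
        (cong (_+_ (ι (p zero))) (count-∷ p (suc zero) (indices≥2 N)))

module LevelShape (n : ℕ) (α : Fin (3 + n) → Bool) where

  half : ℕ → ℕ
  half b = count (λ j → α j ∧ downAdj (4 + n) b (toℕ j)) (allFin (3 + n))

  level-size : count α (allFin (3 + n)) ≤ ι (α zero ∧ α (suc zero)) + (2 + n)
  level-size = ≤-trans (≤-reflexive (count-allFin-2+ α))
    (two (α zero) (α (suc zero)) (≤-trans (count-≤-length α (indices≥2 (1 + n)))
                                          (≤-reflexive (length-tabulate (_↑ʳ_ {1 + n} 2)))))
    where
    two : ∀ a b {r} → r ≤ 1 + n → ι a + (ι b + r) ≤ ι (a ∧ b) + (2 + n)
    two false false r≤ = m≤n⇒m≤1+n r≤
    two false true r≤ = s≤s r≤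
    two true false r≤ = s≤s r≤
    two true true r≤ = s≤s (s≤s r≤)

  halves-disjoint : half 0 + half 1 ≤ count α (allFin (3 + n))
  halves-disjoint = count-∧-disjoint α _ _ (allFin (3 + n)) (disjoint ∘ toℕ)
    where
    disjoint : ∀ x → downAdj (4 + n) 0 x ∧ downAdj (4 + n) 1 x ≡ false
    disjoint x with 2 * x ≤ᵇ 2 + n in lower | 3 + n ≤ᵇ 2 * x in upper
    ... | false | _ = refl
    ... | true | false = refl
    ... | true | true = ⊥-elim (<-irrefl refl (≤-trans (≤ᵇ⇒≤ (3 + n) (2 * x) (subst T (sym upper) _))
                                                       (≤ᵇ⇒≤ (2 * x) (2 + n) (subst T (sym lower) _))))

  lower-half : 2 * half 0 ≤ ι (α zero ∧ α (suc zero)) + (3 + n)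
  lower-half = begin
    2 * half 0
      ≡⟨ cong (2 *_) (count-allFin-2+ (λ j → α j ∧ downAdj (4 + n) 0 (toℕ j))) ⟩
    2 * (ι (α zero ∧ true) + (ι (α (suc zero) ∧ true) + w))
      ≤⟨ two (α zero) (α (suc zero)) 2w≤n ⟩
    ι (α zero ∧ α (suc zero)) + (3 + n)                      ∎
    where
    open ≤-Reasoning
    rest : List (Fin (3 + n))
    rest = indices≥2 (1 + n)
    w = count (λ j → α j ∧ downAdj (4 + n) 0 (toℕ j)) rest
    shift : ∀ x → 2 * (2 + x) ≡ 2 * x + 4
    shift = solve-∀
    2w≤n : 2 * w ≤ n
    2w≤n = begin
      2 * w
        ≤⟨ *-monoʳ-≤ 2 (count-∧-≤ α _ rest) ⟩
      2 * count (λ j → downAdj (4 + n) 0 (toℕ j)) rest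
        ≡⟨ cong (2 *_) (trans (count-tabulate (λ j → downAdj (4 + n) 0 (toℕ j)) (_↑ʳ_ {1 + n} 2))
                              (count-cong (allFin (1 + n)) (λ j → cong (_≤ᵇ 2 + n) (shift (toℕ j))))) ⟩
      2 * count (sample (_≤ᵇ 2 + n) 4) (allFin (1 + n))
        ≤⟨ count-sample-below (1 + n) 4 (2 + n) ⟩
      n                                                         ∎
    two : ∀ a b {w} → 2 * w ≤ n → 2 * (ι (a ∧ true) + (ι (b ∧ true) + w)) ≤ ι (a ∧ b) + (3 + n)
    two false false 2w≤ = m≤n⇒m≤o+n 3 2w≤
    two false true {w} 2w≤ = subst (_≤ 3 + n) (sym (*-suc 2 w)) (s≤s (s≤s (m≤n⇒m≤1+n 2w≤)))
    two true false {w} 2w≤ = subst (_≤ 3 + n) (sym (*-suc 2 w)) (s≤s (s≤s (m≤n⇒m≤1+n 2w≤)))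
    two true true {w} 2w≤ =
      subst (_≤ 4 + n) (sym (trans (*-suc 2 (suc w)) (cong (_+_ 2) (*-suc 2 w)))) (+-monoʳ-≤ 4 2w≤)

  upper-half : 2 * half 1 ≤ 3 + n
  upper-half = begin
    2 * half 1
      ≤⟨ *-monoʳ-≤ 2 (count-∧-≤ α _ (allFin (3 + n))) ⟩
    2 * count (λ j → downAdj (4 + n) 1 (toℕ j)) (allFin (3 + n))
      ≡⟨ cong (2 *_) (count-cong (allFin (3 + n)) (λ j → cong (3 + n ≤ᵇ_) (sym (+-identityʳ (2 * toℕ j))))) ⟩
    2 * count (sample (3 + n ≤ᵇ_) 0) (allFin (3 + n))
      ≤⟨ count-sample-above (3 + n) 0 (3 + n) ⟩
    (2 * (3 + n) + 0) ∸ (3 + n)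
      ≡⟨ trans (cong (_∸ (3 + n)) (double n)) (m+n∸m≡n (3 + n) (3 + n)) ⟩
    3 + n                                                          ∎
    where
    open ≤-Reasoning
    double : ∀ n → 2 * (3 + n) + 0 ≡ (3 + n) + (3 + n)
    double = solve-∀

data Consecutive {N : ℕ} : ℕ → List (Fin N) → Set where
  []  : ∀ {o} → Consecutive o []
  _∷_ : ∀ {o i is} → toℕ i ≡ o → Consecutive (suc o) is → Consecutive o (i ∷ is)

tabulate-consecutive : ∀ {M N} o (g : Fin M → Fin N) → (∀ l → toℕ (g l) ≡ o + toℕ l) →
                       Consecutive o (tabulate g)
tabulate-consecutive {zero} o g _ = []
tabulate-consecutive {suc M} o g g≡ =
  trans (g≡ zero) (+-identityʳ o) ∷
  tabulate-consecutive (suc o) (g ∘ suc) (λ l → trans (g≡ (suc l)) (+-suc o (toℕ l)))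

allFin-consecutive : ∀ N → Consecutive 0 (allFin N)
allFin-consecutive N = tabulate-consecutive 0 id (λ _ → refl)

consecutive-All : ∀ {X : Set} {N} {P : X → Set} {f : Fin N → List X} {o is} → Consecutive o is →
                  (∀ i → o ≤ toℕ i → All P (f i)) → All P (concatMap f is)
consecutive-All [] _ = []
consecutive-All {o = o} (i≡o ∷ rest) h =
  All.++⁺ (h _ (≤-reflexive (sym i≡o)))
          (consecutive-All rest (λ i o<i → h i (≤-trans (n≤1+n o) o<i)))

≡ᵇ-refl : ∀ m → (m ≡ᵇ m) ≡ true
≡ᵇ-refl m = Equivalence.to T-≡ (≡⇒≡ᵇ m m refl)

≢⇒≡ᵇ-false : ∀ {m n} → m ≢ n → (m ≡ᵇ n) ≡ false
≢⇒≡ᵇ-false {m} {n} m≢n with m ≡ᵇ n | ≡ᵇ⇒≡ m n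
... | false | _ = refl
... | true | m≡n = contradiction (m≡n _) m≢n

module Adjacency (n t : ℕ) where

  V : Set
  V = Vtx (4 + n) t

  adj-base : ∀ b c i j →
             adj {4 + n} {t} (base b) (tw c i j) ≡ (toℕ i ≡ᵇ 0) ∧ downAdj (4 + n) (toℕ b) (toℕ j)
  adj-base b c i j = ∨-identityʳ _

  adj-other-copy : ∀ {c c′} i i′ j j′ → toℕ c ≢ toℕ c′ →
                   adj {4 + n} {t} (tw c i j) (tw c′ i′ j′) ≡ false
  adj-other-copy i i′ j j′ c≢c′ rewrite ≢⇒≡ᵇ-false c≢c′ | ≢⇒≡ᵇ-false (≢-sym c≢c′) = refl

  adj-below : ∀ c {i i′} j j′ → toℕ i < toℕ i′ →
              adj {4 + n} {t} (tw c i j) (tw c i′ j′)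
                ≡ (suc (toℕ i) ≡ᵇ toℕ i′) ∧ downAdj (4 + n) (toℕ j) (toℕ j′)
  adj-below c j j′ i<i′ rewrite ≡ᵇ-refl (toℕ c) | ≢⇒≡ᵇ-false (<⇒≢ i<i′) | ≢⇒≡ᵇ-false (>⇒≢ i<i′)
                              | ≢⇒≡ᵇ-false (>⇒≢ (m<n⇒m<1+n i<i′)) = ∨-identityʳ _

  adj-level-01 : ∀ c i → adj {4 + n} {t} (tw c i zero) (tw c i (suc zero)) ≡ false
  adj-level-01 c i rewrite ≡ᵇ-refl (toℕ c) | ≡ᵇ-refl (toℕ i) | ≢⇒≡ᵇ-false (1+n≢n {toℕ i}) = refl

  adj-level-0 : ∀ c i j → adj {4 + n} {t} (tw c i zero) (tw c i (suc (suc j))) ≡ true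
  adj-level-0 c i j rewrite ≡ᵇ-refl (toℕ c) | ≡ᵇ-refl (toℕ i) = refl

  adj-level-1 : ∀ c i j → adj {4 + n} {t} (tw c i (suc zero)) (tw c i (suc (suc j))) ≡ true
  adj-level-1 c i j rewrite ≡ᵇ-refl (toℕ c) | ≡ᵇ-refl (toℕ i) = refl

  adj-level-rest : ∀ c i {j j′} → toℕ j < toℕ j′ →
                   adj {4 + n} {t} (tw c i (suc (suc j))) (tw c i (suc (suc j′))) ≡ true
  adj-level-rest c i j<j′
    rewrite ≡ᵇ-refl (toℕ c) | ≡ᵇ-refl (toℕ i) | Equivalence.to T-≡ (<⇒<ᵇ j<j′) = refl

module TowerComplex (n t : ℕ) (A : Vtx (4 + n) t → Bool) where
  open Adjacency n t
  open Potential n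
  open EdgeCounting A adj
  open Pieces n A adj

  level : Fin (4 + n) → Fin t → List V
  level c i = map (tw c i) (allFin (3 + n))

  tower : Fin (4 + n) → List (Fin t) → List V
  tower c = concatMap (level c)

  forest : List (Fin (4 + n)) → List V
  forest = concatMap (λ c → tower c (allFin t))

  tower-All : ∀ c {P : V → Set} {o is} → Consecutive o is →
              (∀ i j → o ≤ toℕ i → P (tw c i j)) → All P (tower c is)
  tower-All c run h = consecutive-All run (λ i o≤i → All.map⁺ (All.tabulate⁺ (λ j → h i j o≤i)))

  forest-All : ∀ {P : V → Set} {o cs} → Consecutive o cs →
               (∀ c i j → o ≤ toℕ c → P (tw c i j)) → All P (forest cs)
  forest-All run h =
    consecutive-All run (λ c o≤c → tower-All c (allFin-consecutive t) (λ i j _ → h c i j o≤c))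

  Parent : V → ℕ → Fin (4 + n) → ℕ → Set
  Parent p b c o = (∀ i j → toℕ i ≡ o → adj p (tw c i j) ≡ downAdj (4 + n) b (toℕ j))
                 × (∀ i j → suc o ≤ toℕ i → adj p (tw c i j) ≡ false)

  base-parent : ∀ b c → Parent (base b) (toℕ b) c 0
  base-parent b c =
    (λ i j i≡0 → trans (adj-base b c i j) (cong (λ x → (x ≡ᵇ 0) ∧ down j) i≡0)) ,
    (λ i j 0<i → trans (adj-base b c i j) (cong (_∧ down j) (≢⇒≡ᵇ-false (>⇒≢ 0<i))))
    where
    down : Fin (3 + n) → Bool
    down j = downAdj (4 + n) (toℕ b) (toℕ j)

  level-parent : ∀ c {i o} → toℕ i ≡ o → ∀ j → Parent (tw c i j) (toℕ j) c (suc o)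
  level-parent c refl j =
    (λ i′ j′ i′≡ → trans (adj-below c j j′ (≤-reflexive (sym i′≡)))
                         (cong (_∧ down j′) (Equivalence.to T-≡ (≡⇒≡ᵇ _ _ (sym i′≡))))) ,
    (λ i′ j′ i<i′ → trans (adj-below c j j′ (<⇒≤ i<i′)) (cong (_∧ down j′) (≢⇒≡ᵇ-false (<⇒≢ i<i′))))
    where
    down : Fin (3 + n) → Bool
    down j′ = downAdj (4 + n) (toℕ j) (toℕ j′)

  module _ (c : Fin (4 + n)) (i : Fin t) where
    private
      α : Fin (3 + n) → Bool
      α j = A (tw c i j)
      U R : List V
      U = tw c i zero ∷ tw c i (suc zero) ∷ []
      R = map (tw c i) (indices≥2 (1 + n))
    open LevelShape n α

    level-edges : 2 * edges (level c i) + 2 * ι (α zero ∧ α (suc zero)) + count A (level c i)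
                  ≡ count A (level c i) * count A (level c i)
    level-edges =
      clique-minus-edge-edges (adj-level-01 c i) (joined (adj-level-0 c i)) (joined (adj-level-1 c i)) clique
      where
      joined : ∀ {u} → (∀ j → adj u (tw c i (suc (suc j))) ≡ true) → All (λ v → adj u v ≡ true) R
      joined h = All.map⁺ (All.tabulate⁺ h)
      clique : AllPairs (λ u v → adj u v ≡ true) R
      clique = AllPairs.map⁺ (AllPairs.tabulate⁺-< {f = _↑ʳ_ {1 + n} 2} (adj-level-rest c i))

    count-level : ∀ (p : V → Bool) → count p (level c i) ≡ count (p ∘ tw c i) (allFin (3 + n))
    count-level p = count-map p (tw c i) (allFin (3 + n))

    deg-level : ∀ {p b o} → Parent p b c o → toℕ i ≡ o → deg p (level c i) ≡ half b
    deg-level {p} (down , _) i≡o =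
      trans (count-level (λ v → A v ∧ adj p v)) (count-cong (allFin (3 + n)) (λ j → cong (α j ∧_) (down i j i≡o)))

    level-piece : ∀ {p₀ p₁ o} → Parent p₀ 0 c o → Parent p₁ 1 c o → toℕ i ≡ o →
                  PotentialBound (count A (p₀ ∷ p₁ ∷ [])) (count A (level c i))
                                 (φ (count A (level c i)) (cost (p₀ ∷ p₁ ∷ []) (level c i)))
    level-piece {p₀} {p₁} par₀ par₁ i≡o =
      subst₂ (λ j x → PotentialBound j s x) (sym (count-pair A p₀ p₁)) (cong (φ s) (sym cost≡))
        (level-bound (A p₀) (A p₁) {s} {z} {edges (level c i)} {half 0} {half 1} (ι≤1 (α zero ∧ α (suc zero)))
                     (subst (_≤ z + (2 + n)) (sym (count-level A)) level-size)
                     level-edges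
                     (subst (half 0 + half 1 ≤_) (sym (count-level A)) halves-disjoint)
                     lower-half upper-half)
      where
      s = count A (level c i)
      z = ι (α zero ∧ α (suc zero))
      cost≡ : cost (p₀ ∷ p₁ ∷ []) (level c i)
              ≡ edges (level c i) + ((if A p₀ then half 0 else 0) + (if A p₁ then half 1 else 0))
      cost≡ = cong (_+_ (edges (level c i)))
        (cong₂ _+_ (cong (if A p₀ then_else 0) (deg-level {p₀} {0} par₀ i≡o))
                   (trans (+-identityʳ _) (cong (if A p₁ then_else 0) (deg-level {p₁} {1} par₁ i≡o))))

    tower-cost-split : ∀ {p₀ p₁ o is} → Parent p₀ 0 c o → Parent p₁ 1 c o → toℕ i ≡ o →
                       Consecutive (suc o) is →
                       cost (p₀ ∷ p₁ ∷ []) (level c i ++ tower c is)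
                         ≡ cost (p₀ ∷ p₁ ∷ []) (level c i) + cost U (tower c is)
    tower-cost-split {p₀} {p₁} {o} {is} par₀ par₁ i≡o run = begin
      cost P (L ++ Ts)
        ≡⟨ cost-++ P L Ts ⟩
      cost P L + (edges Ts + between P Ts) + between (U ++ R) Ts
        ≡⟨ cong₂ (λ x y → cost P L + (edges Ts + x) + y)
                 (between-none (below {b = 0} par₀ ∷ below {b = 1} par₁ ∷ []))
                 (trans (between-++ˡ U R Ts) (cong (_+_ (between U Ts)) (between-none rest-below))) ⟩
      cost P L + (edges Ts + 0) + (between U Ts + 0)
        ≡⟨ cong₂ (λ x y → cost P L + x + y) (+-identityʳ _) (+-identityʳ _) ⟩
      cost P L + edges Ts + between U Ts
        ≡⟨ +-assoc (cost P L) (edges Ts) (between U Ts) ⟩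
      cost P L + cost U Ts ∎
      where
      open ≡-Reasoning
      P L Ts : List V
      P = p₀ ∷ p₁ ∷ []
      L = level c i
      Ts = tower c is
      below : ∀ {p b} → Parent p b c o → All (λ v → adj p v ≡ false) Ts
      below (_ , deeper) = tower-All c run deeper
      rest-below : All (λ u → All (λ v → adj u v ≡ false) Ts) R
      rest-below = All.map⁺ (All.tabulate⁺ (λ x → tower-All c run (λ i′ j′ o<i′ →
        trans (adj-below c (suc (suc x)) j′ (subst (_< toℕ i′) (sym i≡o) o<i′)) (∧-zeroʳ _))))

    level-attachments≤ : count A U ≤ count A (level c i)
    level-attachments≤ = subst (count A U ≤_) (sym (count-++ A U R)) (m≤m+n (count A U) (count A R))

  tower-bound : ∀ c {o is} → Consecutive o is → ∀ {p₀ p₁} → Parent p₀ 0 c o → Parent p₁ 1 c o →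
                PieceBound (p₀ ∷ p₁ ∷ []) (tower c is)
  tower-bound c [] {p₀} {p₁} _ _ = piece-[] (p₀ ∷ p₁ ∷ [])
  tower-bound c (_∷_ {i = i} {is} i≡o run) {p₀} {p₁} par₀ par₁ =
    piece-series (p₀ ∷ p₁ ∷ []) (tw c i zero ∷ tw c i (suc zero) ∷ []) {level c i} {tower c is}
      (level-attachments≤ c i) (tower-cost-split c i par₀ par₁ i≡o run) (level-piece c i par₀ par₁ i≡o)
      (tower-bound c run (level-parent c i≡o zero) (level-parent c i≡o (suc zero)))

  b₀ b₁ : V
  b₀ = base zero
  b₁ = base (suc zero)

  V₀ : List V
  V₀ = b₀ ∷ b₁ ∷ []

  forest-bound : ∀ {o cs} → Consecutive o cs → PieceBound V₀ (forest cs)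
  forest-bound [] = piece-[] V₀
  forest-bound (_∷_ {i = c} {cs} c≡o run) =
    piece-parallel V₀ {tower c (allFin t)} {forest cs} (between-none separated)
      (tower-bound c (allFin-consecutive t) (base-parent zero c) (base-parent (suc zero) c))
      (forest-bound run)
    where
    separated : All (λ u → All (λ v → adj u v ≡ false) (forest cs)) (tower c (allFin t))
    separated = tower-All c (allFin-consecutive t) (λ i j _ →
      forest-All {λ v → adj (tw c i j) v ≡ false} run (λ c′ i′ j′ o<c′ →
        adj-other-copy i i′ j j′ (<⇒≢ (subst (_< toℕ c′) (sym c≡o) o<c′))))

  towers : List V
  towers = forest (allFin (4 + n))

  card-split : card A ≡ ι (A b₀) + (ι (A b₁) + count A towers)
  card-split = trans (count-∷ A b₀ (b₁ ∷ towers)) (cong (_+_ (ι (A b₀))) (count-∷ A b₁ towers))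

  edges-split : edgesIn A ≡ cost V₀ towers
  edges-split = begin
    edgesIn A
      ≡⟨ edges-∷ b₀ (b₁ ∷ towers) ⟩
    (if A b₀ then deg b₀ (b₁ ∷ towers) else 0) + edges (b₁ ∷ towers)
      ≡⟨ cong₂ _+_ (cong (if A b₀ then_else 0) b₀≁b₁) (edges-∷ b₁ towers) ⟩
    d₀ + (d₁ + edges towers)
      ≡⟨ rotate d₀ d₁ (edges towers) ⟩
    cost V₀ towers ∎
    where
    open ≡-Reasoning
    d₀ = if A b₀ then deg b₀ towers else 0
    d₁ = if A b₁ then deg b₁ towers else 0
    b₀≁b₁ : deg b₀ (b₁ ∷ towers) ≡ deg b₀ towers
    b₀≁b₁ = trans (count-∷ _ b₁ towers) (cong (λ x → ι x + deg b₀ towers) (∧-zeroʳ (A b₁)))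
    rotate : ∀ a b e → a + (b + e) ≡ e + (a + (b + 0))
    rotate = solve-∀

  complex-bound : (2 ≤ card A → + (2 * vw) - + ew ℤ.≤ φ (card A) (edgesIn A))
                × (A b₀ ≡ true → A b₁ ≡ true → + (2 * vw) ℤ.≤ φ (card A) (edgesIn A))
  complex-bound rewrite card-split | edges-split =
    bound-with-base (A b₀) (A b₁) {count A towers} {cost V₀ towers}
      (subst (λ j → PotentialBound j (count A towers) (φ (count A towers) (cost V₀ towers)))
             (count-pair A b₀ b₁) (forest-bound (allFin-consecutive (4 + n))))

lemma4p3 : (k t : ℕ) → 4 ≤ k → 1 ≤ t → (A : Vtx k t → Bool) →
    (2 ≤ card A → + (2 * (k + 1) * (k ∸ 2)) - + (2 * (k ∸ 1)) ℤ.≤ ρ k t A)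
    × (A (base zero) ≡ true → A (base (suc zero)) ≡ true → + (2 * (k + 1) * (k ∸ 2)) ℤ.≤ ρ k t A)
lemma4p3 _ t (s≤s (s≤s (s≤s (s≤s {n = n} z≤n)))) _ A =
  (λ 2≤|A| → subst₂ ℤ._≤_ (cong (λ x → + x - + ew) (sym 2vw≡)) (sym ρ≡φ) (proj₁ complex-bound 2≤|A|)) ,
  (λ A₀ A₁ → subst₂ ℤ._≤_ (cong +_ (sym 2vw≡)) (sym ρ≡φ) (proj₂ complex-bound A₀ A₁))
  where
  open Potential n
  open TowerComplex n t A
  k+1≡5+n : 4 + n + 1 ≡ 5 + n
  k+1≡5+n = +-comm (4 + n) 1
  2vw≡ : 2 * (4 + n + 1) * (2 + n) ≡ 2 * vw
  2vw≡ = trans (cong (λ x → 2 * x * (2 + n)) k+1≡5+n) (*-assoc 2 (5 + n) (2 + n))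
  ρ≡φ : ρ (4 + n) t A ≡ φ (card A) (edgesIn A)
  ρ≡φ = cong (λ x → + (x * (2 + n) * card A) - + (ew * edgesIn A)) k+1≡5+n
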